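{- Let $a,b,c\in\mathbb{Z}$ with $ac\neq0$ and $\Delta=a^2-4bc\neq0$, and let $h(x)=cx^4+ax^2+b$. Then every integer solution $(x_0,y_0)\in\mathbb{Z}^2$ of $cy^2=h(x)$ is of the form $$(x_0,|y_0|)=\left(\pm\sqrt{\frac{d_1+d_2-2a}{4c}},\ \left|\frac{d_1-d_2}{4c}\right|\right)$$ for some integers $d_1,d_2$ of the same parity with $d_1d_2=\Delta$ (for which the square root is an integer). -}

module Defs where

open import Data.Integer using (ℤ; +_; _+_; _*_; _-_; _^_)

h : ℤ → ℤ → ℤ → ℤ → ℤ
h a b c x = c * x ^ 4 + a * x ^ 2 + b

Δ : ℤ → ℤ → ℤ → ℤ
Δ a b c = a ^ 2 - + 4 * b * c

-- Completing the square gives (2cx² + a)² − 4c·h(x) = Δ. On a solution 4c·h(x) = (2cy)²,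
-- so Δ = (2cx² + a)² − (2cy)² factors as d₁d₂ with d₁, d₂ = 2cx² + a ± 2cy.
module Submission where

open import Defs
open import Data.Integer using (ℤ; +_; _+_; _*_; _-_; _^_; ∣_∣)
open import Data.Integer.Divisibility using (_∣_)
open import Data.Integer.Properties using (abs-*)
open import Data.Integer.Solver using (module +-*-Solver)
import Data.Nat as ℕ
open import Data.Nat.Divisibility using (divides)
open import Data.Product using (∃₂; _×_; _,_)
open import Relation.Binary.PropositionalEquality using (_≡_; _≢_; refl; cong)
open Relation.Binary.PropositionalEquality.≡-Reasoning

open +-*-Solver

[u+v]*[u-v]≡u²-v² : ∀ u v → (u + v) * (u - v) ≡ u ^ 2 - v ^ 2
[u+v]*[u-v]≡u²-v² = solve 2 (λ u v → (u :+ v) :* (u :- v) := u :^ 2 :- v :^ 2) refl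

[u+v]+[u-v]≡2*u : ∀ u v → (u + v) + (u - v) ≡ (+ 2) * u
[u+v]+[u-v]≡2*u = solve 2 (λ u v → (u :+ v) :+ (u :- v) := con (+ 2) :* u) refl

[u+v]-[u-v]≡v*2 : ∀ u v → (u + v) - (u - v) ≡ v * (+ 2)
[u+v]-[u-v]≡v*2 = solve 2 (λ u v → (u :+ v) :- (u :- v) := v :* con (+ 2)) refl

2∣[u+v]-[u-v] : ∀ u v → (+ 2) ∣ (u + v) - (u - v)
2∣[u+v]-[u-v] u v = divides ∣ v ∣ (begin
  ∣ (u + v) - (u - v) ∣ ≡⟨ cong ∣_∣ ([u+v]-[u-v]≡v*2 u v) ⟩
  ∣ v * (+ 2) ∣         ≡⟨ abs-* v (+ 2) ⟩
  ∣ v ∣ ℕ.* 2           ∎)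

[2cx²+a]²-4c*h≡Δ : ∀ a b c x → ((+ 2) * c * x ^ 2 + a) ^ 2 - (+ 4) * c * h a b c x ≡ Δ a b c
[2cx²+a]²-4c*h≡Δ = solve 4 (λ a b c x →
  (con (+ 2) :* c :* x :^ 2 :+ a) :^ 2 :- con (+ 4) :* c :* (c :* x :^ 4 :+ a :* x :^ 2 :+ b)
    := a :^ 2 :- con (+ 4) :* b :* c) refl

[2cy]²≡4c*cy² : ∀ c y → ((+ 2) * c * y) ^ 2 ≡ (+ 4) * c * (c * y ^ 2)
[2cy]²≡4c*cy² = solve 2 (λ c y → (con (+ 2) :* c :* y) :^ 2 := con (+ 4) :* c :* (c :* y :^ 2)) refl

2[2cx²+a]-2a≡4cx² : ∀ a c x → (+ 2) * ((+ 2) * c * x ^ 2 + a) - (+ 2) * a ≡ (+ 4) * c * x ^ 2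
2[2cx²+a]-2a≡4cx² = solve 3 (λ a c x →
  con (+ 2) :* (con (+ 2) :* c :* x :^ 2 :+ a) :- con (+ 2) :* a := con (+ 4) :* c :* x :^ 2) refl

2cy*2≡4cy : ∀ c y → (+ 2) * c * y * (+ 2) ≡ (+ 4) * c * y
2cy*2≡4cy = solve 2 (λ c y → con (+ 2) :* c :* y :* con (+ 2) := con (+ 4) :* c :* y) refl

corollary2 : (a b c : ℤ) → a * c ≢ (+ 0) → Δ a b c ≢ (+ 0) →
    (x₀ y₀ : ℤ) → c * y₀ ^ 2 ≡ h a b c x₀ →
    ∃₂ λ (d₁ d₂ : ℤ) → ((+ 2) ∣ d₁ - d₂) × (d₁ * d₂ ≡ Δ a b c)
      × (d₁ + d₂ - (+ 2) * a ≡ (+ 4) * c * x₀ ^ 2)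
      × (∣ d₁ - d₂ ∣ ≡ ∣ (+ 4) * c * y₀ ∣)
corollary2 a b c _ _ x y on-curve = u + v , u - v , 2∣[u+v]-[u-v] u v , product , sum , difference
  where
  u v : ℤ
  u = (+ 2) * c * x ^ 2 + a
  v = (+ 2) * c * y

  product : (u + v) * (u - v) ≡ Δ a b c
  product = begin
    (u + v) * (u - v)                 ≡⟨ [u+v]*[u-v]≡u²-v² u v ⟩
    u ^ 2 - v ^ 2                     ≡⟨ cong (λ t → u ^ 2 - t) ([2cy]²≡4c*cy² c y) ⟩
    u ^ 2 - (+ 4) * c * (c * y ^ 2)   ≡⟨ cong (λ t → u ^ 2 - (+ 4) * c * t) on-curve ⟩
    u ^ 2 - (+ 4) * c * h a b c x     ≡⟨ [2cx²+a]²-4c*h≡Δ a b c x ⟩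
    Δ a b c                           ∎

  sum : (u + v) + (u - v) - (+ 2) * a ≡ (+ 4) * c * x ^ 2
  sum = begin
    (u + v) + (u - v) - (+ 2) * a     ≡⟨ cong (_- (+ 2) * a) ([u+v]+[u-v]≡2*u u v) ⟩
    (+ 2) * u - (+ 2) * a             ≡⟨ 2[2cx²+a]-2a≡4cx² a c x ⟩
    (+ 4) * c * x ^ 2                 ∎

  difference : ∣ (u + v) - (u - v) ∣ ≡ ∣ (+ 4) * c * y ∣
  difference = cong ∣_∣ (begin
    (u + v) - (u - v)                 ≡⟨ [u+v]-[u-v]≡v*2 u v ⟩
    v * (+ 2)                         ≡⟨ 2cy*2≡4cy c y ⟩
    (+ 4) * c * y                     ∎)
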